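{- Let $m \geq 1$ and let $\varphi(X,\vec z)$ be any formula (over a language containing the sorts $\mathsf i$, $\mathsf{list}$ and the symbols $\mathit{nil}$, $\mathit{cons}$). Then the following formula is provable in pure first-order logic: \[ I_X\Big(\bigwedge_{i=1}^{m}\forall x_1\dots\forall x_{i-1}\,\varphi(\mathit{cons}(x_1,\dots,x_{i-1};X),\vec z)\Big) \rightarrow I^{m}_{X}\varphi(X,\vec z). \]
   Context: Many-sorted first-order logic with equality; $\mathsf{i}$ is the sort of elements and $\mathsf{list}$ the sort of lists, with $\mathit{nil}:\mathsf{list}$ and $\mathit{cons}:\mathsf{i}\times\mathsf{list}\to\mathsf{list}$. $\mathit{cons}(t_1,\dots,t_n;T)$ abbreviates $\mathit{cons}(t_1,\mathit{cons}(t_2,\dots,\mathit{cons}(t_n,T)\dots))$ ($=T$ if $n=0$). For a formula $\psi(X,\vec z)$, the one-step induction axiom $I_X\psi$ is $\big(\psi(\mathit{nil},\vec z)\wedge\forall X\,\forall x\,(\psi(X,\vec z)\rightarrow\psi(\mathit{cons}(x,X),\vec z))\big)\rightarrow\forall X\,\psi(X,\vec z)$. For $m\ge1$, the $m$-step induction axiom $I^m_X\varphi$ is \[ \Big(\bigwedge_{i=1}^{m} \forall x_1\dots\forall x_{i-1}\, \varphi(\mathit{cons}(x_1,\dots,x_{i-1};\mathit{nil}),\vec z) \wedge \forall X\,\forall x_1\dots\forall x_m\,\big(\varphi(X,\vec z)\rightarrow \varphi(\mathit{cons}(x_1,\dots,x_m;X),\vec z)\big)\Big) \rightarrow \forall X\,\varphi(X,\vec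 z). \] -}

module Defs where

open import Data.Nat using (ℕ; zero; suc)
open import Data.List using (List; []; _∷_; map; replicate; _++_)
open import Data.List.Membership.Propositional using (_∈_)

record Signature : Set₁ where
  field
    Sort : Set
    ι    : Sort
    lst  : Sort
    Fun  : List Sort → Sort → Set
    Pred : List Sort → Set
    nil  : Fun [] lst
    cons : Fun (ι ∷ lst ∷ []) lst

module Syntax (Σ : Signature) where
  open Signature Σ public

  Ctx : Set
  Ctx = List Sort

  -- de Bruijn variables (vz = most recently bound variable)
  data Var : Ctx → Sort → Set where
    vz : ∀ {Γ s} → Var (s ∷ Γ) s
    vs : ∀ {Γ s t} → Var Γ s → Var (t ∷ Γ) s

  mutual
    data Tm (Γ : Ctx) : Sort → Set where
      var : ∀ {s} → Var Γ s → Tm Γ s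
      app : ∀ {ss s} → Fun ss s → Tms Γ ss → Tm Γ s

    data Tms (Γ : Ctx) : List Sort → Set where
      []ₜ  : Tms Γ []
      _∷ₜ_ : ∀ {s ss} → Tm Γ s → Tms Γ ss → Tms Γ (s ∷ ss)

  Ren : Ctx → Ctx → Set
  Ren Γ Δ = ∀ {s} → Var Γ s → Var Δ s

  Sub : Ctx → Ctx → Set
  Sub Γ Δ = ∀ {s} → Var Γ s → Tm Δ s

  mutual
    ren : ∀ {Γ Δ s} → Ren Γ Δ → Tm Γ s → Tm Δ s
    ren ρ (var x)    = var (ρ x)
    ren ρ (app f ts) = app f (rens ρ ts)

    rens : ∀ {Γ Δ ss} → Ren Γ Δ → Tms Γ ss → Tms Δ ss
    rens ρ []ₜ       = []ₜ
    rens ρ (t ∷ₜ ts) = ren ρ t ∷ₜ rens ρ ts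

  mutual
    subT : ∀ {Γ Δ s} → Sub Γ Δ → Tm Γ s → Tm Δ s
    subT σ (var x)    = σ x
    subT σ (app f ts) = app f (subTs σ ts)

    subTs : ∀ {Γ Δ ss} → Sub Γ Δ → Tms Γ ss → Tms Δ ss
    subTs σ []ₜ       = []ₜ
    subTs σ (t ∷ₜ ts) = subT σ t ∷ₜ subTs σ ts

  lift : ∀ {Γ Δ t} → Sub Γ Δ → Sub (t ∷ Γ) (t ∷ Δ)
  lift σ vz     = var vz
  lift σ (vs x) = ren vs (σ x)

  infixr 4 _⇒_
  infixr 5 _∨_
  infixr 6 _∧_
  data Fm (Γ : Ctx) : Set where
    ⊥'   : Fm Γ
    atom : ∀ {ss} → Pred ss → Tms Γ ss → Fm Γ
    _≐_  : ∀ {s} → Tm Γ s → Tm Γ s → Fm Γ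
    _⇒_  : Fm Γ → Fm Γ → Fm Γ
    _∧_  : Fm Γ → Fm Γ → Fm Γ
    _∨_  : Fm Γ → Fm Γ → Fm Γ
    ∀'   : (s : Sort) → Fm (s ∷ Γ) → Fm Γ
    ∃'   : (s : Sort) → Fm (s ∷ Γ) → Fm Γ

  ⊤' : ∀ {Γ} → Fm Γ
  ⊤' = ⊥' ⇒ ⊥'

  sub : ∀ {Γ Δ} → Sub Γ Δ → Fm Γ → Fm Δ
  sub σ ⊥'         = ⊥'
  sub σ (atom P ts) = atom P (subTs σ ts)
  sub σ (t ≐ u)    = subT σ t ≐ subT σ u
  sub σ (A ⇒ B)    = sub σ A ⇒ sub σ B
  sub σ (A ∧ B)    = sub σ A ∧ sub σ B
  sub σ (A ∨ B)    = sub σ A ∨ sub σ B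
  sub σ (∀' s A)   = ∀' s (sub (lift σ) A)
  sub σ (∃' s A)   = ∃' s (sub (lift σ) A)

  wkF : ∀ {Γ s} → Fm Γ → Fm (s ∷ Γ)
  wkF = sub (λ x → var (vs x))

  single : ∀ {Γ s} → Tm Γ s → Sub (s ∷ Γ) Γ
  single t vz     = t
  single t (vs x) = var x

  _[_] : ∀ {Γ s} → Fm (s ∷ Γ) → Tm Γ s → Fm Γ
  A [ t ] = sub (single t) A

  data Pf : (Γ : Ctx) → List (Fm Γ) → Fm Γ → Set where
    hyp  : ∀ {Γ Δ A} → A ∈ Δ → Pf Γ Δ A
    raa  : ∀ {Γ Δ A} → Pf Γ ((A ⇒ ⊥') ∷ Δ) ⊥' → Pf Γ Δ A
    ⇒I   : ∀ {Γ Δ A B} → Pf Γ (A ∷ Δ) B → Pf Γ Δ (A ⇒ B)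
    ⇒E   : ∀ {Γ Δ A B} → Pf Γ Δ (A ⇒ B) → Pf Γ Δ A → Pf Γ Δ B
    ∧I   : ∀ {Γ Δ A B} → Pf Γ Δ A → Pf Γ Δ B → Pf Γ Δ (A ∧ B)
    ∧E₁  : ∀ {Γ Δ A B} → Pf Γ Δ (A ∧ B) → Pf Γ Δ A
    ∧E₂  : ∀ {Γ Δ A B} → Pf Γ Δ (A ∧ B) → Pf Γ Δ B
    ∨I₁  : ∀ {Γ Δ A B} → Pf Γ Δ A → Pf Γ Δ (A ∨ B)
    ∨I₂  : ∀ {Γ Δ A B} → Pf Γ Δ B → Pf Γ Δ (A ∨ B)
    ∨E   : ∀ {Γ Δ A B C} → Pf Γ Δ (A ∨ B) → Pf Γ (A ∷ Δ) C → Pf Γ (B ∷ Δ) C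
           → Pf Γ Δ C
    ∀I   : ∀ {Γ Δ s A} → Pf (s ∷ Γ) (map wkF Δ) A → Pf Γ Δ (∀' s A)
    ∀E   : ∀ {Γ Δ s A} → Pf Γ Δ (∀' s A) → (t : Tm Γ s) → Pf Γ Δ (A [ t ])
    ∃I   : ∀ {Γ Δ s A} → (t : Tm Γ s) → Pf Γ Δ (A [ t ]) → Pf Γ Δ (∃' s A)
    ∃E   : ∀ {Γ Δ s A B} → Pf Γ Δ (∃' s A) → Pf (s ∷ Γ) (A ∷ map wkF Δ) (wkF B)
           → Pf Γ Δ B
    ≐refl : ∀ {Γ Δ s} (t : Tm Γ s) → Pf Γ Δ (t ≐ t)
    ≐E   : ∀ {Γ Δ s t u} (A : Fm (s ∷ Γ)) → Pf Γ Δ (t ≐ u) → Pf Γ Δ (A [ t ])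
           → Pf Γ Δ (A [ u ])

  ⊢_ : ∀ {Γ} → Fm Γ → Set
  ⊢_ {Γ} A = Pf Γ [] A

  nilT : ∀ {Γ} → Tm Γ lst
  nilT = app nil []ₜ

  consT : ∀ {Γ} → Tm Γ ι → Tm Γ lst → Tm Γ lst
  consT x X = app cons (x ∷ₜ (X ∷ₜ []ₜ))

  consTs : ∀ {Γ} → List (Tm Γ ι) → Tm Γ lst → Tm Γ lst
  consTs []       T = T
  consTs (t ∷ ts) T = consT t (consTs ts T)

  -- context extended by k element variables x₁ … xₖ (xₖ innermost)
  _⊕_ : ℕ → Ctx → Ctx
  k ⊕ Δ = replicate k ι ++ Δ

  wk : ∀ {Δ s} (k : ℕ) → Tm Δ s → Tm (k ⊕ Δ) s
  wk zero    T = T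
  wk (suc k) T = ren vs (wk k T)

  xs : ∀ {Δ} (k : ℕ) → List (Tm (k ⊕ Δ) ι)
  xs zero    = []
  xs (suc k) = map (ren vs) (xs k) ++ (var vz ∷ [])

  ∀ⁿ : ∀ {Δ} (k : ℕ) → Fm (k ⊕ Δ) → Fm Δ
  ∀ⁿ zero    A = A
  ∀ⁿ (suc k) A = ∀ⁿ k (∀' ι A)

  -- substitution X := cons(x₁,…,xₖ;T), z⃗ := ρ(z⃗)
  atCons : ∀ {Γ Δ} (k : ℕ) → Tm Δ lst → Sub Γ Δ → Sub (lst ∷ Γ) (k ⊕ Δ)
  atCons k T ρ vz     = consTs (xs k) (wk k T)
  atCons k T ρ (vs z) = wk k (ρ z)

  -- ⋀_{i=1}^{m} f(i-1)   (empty conjunction = ⊤)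
  ⋀ : ∀ {Γ} → ℕ → (ℕ → Fm Γ) → Fm Γ
  ⋀ zero          f = ⊤'
  ⋀ (suc zero)    f = f zero
  ⋀ (suc (suc n)) f = f zero ∧ ⋀ (suc n) (λ j → f (suc j))

  idS : ∀ {Γ} → Sub Γ Γ
  idS = var

  wk1S : ∀ {Γ} → Sub Γ (lst ∷ Γ)
  wk1S z = var (vs z)

  -- one-step induction axiom I_X ψ (X = bound variable vz of ψ)
  IX : ∀ {Γ} → Fm (lst ∷ Γ) → Fm Γ
  IX ψ = ( sub (atCons 0 nilT idS) ψ
         ∧ ∀' lst (∀' ι (wkF ψ ⇒ sub (atCons 1 (var vz) wk1S) ψ)) )
         ⇒ ∀' lst ψ

  Im : ∀ {Γ} → ℕ → Fm (lst ∷ Γ) → Fm Γ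
  Im m φ = ( ⋀ m (λ j → ∀ⁿ j (sub (atCons j nilT idS) φ))
           ∧ ∀' lst (∀ⁿ m (sub (λ v → wk m (var v)) φ
                            ⇒ sub (atCons m (var vz) wk1S) φ)) )
           ⇒ ∀' lst φ

  Ψ : ∀ {Γ} → ℕ → Fm (lst ∷ Γ) → Fm (lst ∷ Γ)
  Ψ m φ = ⋀ m (λ j → ∀ⁿ j (sub (atCons j (var vz) wk1S) φ))

-- Let ψ(X) be the conjunction of the formulas ∀x₁…∀xⱼ φ(cons(x₁,…,xⱼ;X)) for
-- j < m, so that ψ(nil) is the base case of the m-step axiom. Moreover
-- ψ(X) → ψ(cons(x,X)): for j + 1 < m the j-th conjunct of ψ(cons(x,X)) is an
-- instance of the (j+1)-th conjunct of ψ(X), and the last one,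
-- ∀x₁…∀x_{m-1} φ(cons(x₁,…,x_{m-1},x;X)), follows from the 0-th conjunct φ(X)
-- by the m-step hypothesis. One-step induction on ψ thus yields ∀X ψ(X),
-- whose 0-th conjunct is φ(X).
module Submission where

open import Defs
open import Data.Nat using (ℕ; _≤_; zero; suc; _<_; s≤s; z≤n; z<s)
open import Data.Nat.Properties using (m<1+n⇒m<n∨m≡n)
open import Data.List using (List; []; _∷_; map; _++_)
open import Data.List.Properties using (map-++; map-∘; map-cong; map-id)
open import Data.List.Relation.Binary.Subset.Propositional using (_⊆_)
open import Data.List.Relation.Binary.Subset.Propositional.Properties using (map⁺; ∷⁺ʳ)
open import Data.List.Relation.Unary.Any using (here; there)
open import Data.Sum using (inj₁; inj₂)
open import Relation.Binary.Bundles using (Preorder)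
open import Relation.Binary.PropositionalEquality
  using (_≡_; refl; sym; trans; cong; cong₂; subst; isEquivalence; module ≡-Reasoning)
import Relation.Binary.Reasoning.Preorder as PreorderReasoning

module _ (Sg : Signature) where
  open Syntax Sg

  infix 4 _≗ˢ_
  _≗ˢ_ : ∀ {Γ Δ} → Sub Γ Δ → Sub Γ Δ → Set
  _≗ˢ_ {Γ} σ τ = ∀ {s} (v : Var Γ s) → σ v ≡ τ v

  infixr 9 _⊙_
  _⊙_ : ∀ {Γ Δ Θ} → Sub Δ Θ → Sub Γ Δ → Sub Γ Θ
  (σ ⊙ τ) v = subT σ (τ v)

  wkS : ∀ {Γ s} → Sub Γ (s ∷ Γ)
  wkS v = var (vs v)

  mutual
    subT-cong : ∀ {Γ Δ s} {σ τ : Sub Γ Δ} → σ ≗ˢ τ → (t : Tm Γ s) → subT σ t ≡ subT τ t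
    subT-cong e (var x)    = e x
    subT-cong e (app f ts) = cong (app f) (subTs-cong e ts)

    subTs-cong : ∀ {Γ Δ ss} {σ τ : Sub Γ Δ} → σ ≗ˢ τ → (ts : Tms Γ ss) → subTs σ ts ≡ subTs τ ts
    subTs-cong e []ₜ       = refl
    subTs-cong e (t ∷ₜ ts) = cong₂ _∷ₜ_ (subT-cong e t) (subTs-cong e ts)

  mutual
    ren-subT : ∀ {Γ Δ s} (ρ : Ren Γ Δ) (t : Tm Γ s) → ren ρ t ≡ subT (λ v → var (ρ v)) t
    ren-subT ρ (var x)    = refl
    ren-subT ρ (app f ts) = cong (app f) (rens-subTs ρ ts)

    rens-subTs : ∀ {Γ Δ ss} (ρ : Ren Γ Δ) (ts : Tms Γ ss) → rens ρ ts ≡ subTs (λ v → var (ρ v)) ts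
    rens-subTs ρ []ₜ       = refl
    rens-subTs ρ (t ∷ₜ ts) = cong₂ _∷ₜ_ (ren-subT ρ t) (rens-subTs ρ ts)

  mutual
    subT-⊙ : ∀ {Γ Δ Θ s} (σ : Sub Δ Θ) (τ : Sub Γ Δ) (t : Tm Γ s) →
             subT σ (subT τ t) ≡ subT (σ ⊙ τ) t
    subT-⊙ σ τ (var x)    = refl
    subT-⊙ σ τ (app f ts) = cong (app f) (subTs-⊙ σ τ ts)

    subTs-⊙ : ∀ {Γ Δ Θ ss} (σ : Sub Δ Θ) (τ : Sub Γ Δ) (ts : Tms Γ ss) →
              subTs σ (subTs τ ts) ≡ subTs (σ ⊙ τ) ts
    subTs-⊙ σ τ []ₜ       = refl
    subTs-⊙ σ τ (t ∷ₜ ts) = cong₂ _∷ₜ_ (subT-⊙ σ τ t) (subTs-⊙ σ τ ts)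

  mutual
    subT-var : ∀ {Γ s} (t : Tm Γ s) → subT var t ≡ t
    subT-var (var x)    = refl
    subT-var (app f ts) = cong (app f) (subTs-var ts)

    subTs-var : ∀ {Γ ss} (ts : Tms Γ ss) → subTs var ts ≡ ts
    subTs-var []ₜ       = refl
    subTs-var (t ∷ₜ ts) = cong₂ _∷ₜ_ (subT-var t) (subTs-var ts)

  subT-lift-vs : ∀ {Γ Δ s r} (σ : Sub Γ Δ) (u : Tm Γ s) →
                 subT (lift {t = r} σ) (ren vs u) ≡ ren vs (subT σ u)
  subT-lift-vs σ u = begin
    subT (lift σ) (ren vs u)     ≡⟨ cong (subT (lift σ)) (ren-subT vs u) ⟩
    subT (lift σ) (subT wkS u)   ≡⟨ subT-⊙ (lift σ) wkS u ⟩
    subT (lift σ ⊙ wkS) u        ≡⟨ subT-cong (λ v → ren-subT vs (σ v)) u ⟩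
    subT (wkS ⊙ σ) u             ≡⟨ subT-⊙ wkS σ u ⟨
    subT wkS (subT σ u)          ≡⟨ ren-subT vs (subT σ u) ⟨
    ren vs (subT σ u)            ∎
    where open ≡-Reasoning

  subT-single-vs : ∀ {Γ s r} (t : Tm Γ r) (u : Tm Γ s) → subT (single t) (ren vs u) ≡ u
  subT-single-vs t u =
    trans (cong (subT (single t)) (ren-subT vs u)) (trans (subT-⊙ (single t) wkS u) (subT-var u))

  lift-cong : ∀ {Γ Δ r} {σ τ : Sub Γ Δ} → σ ≗ˢ τ → lift {t = r} σ ≗ˢ lift τ
  lift-cong e vz     = refl
  lift-cong e (vs x) = cong (ren vs) (e x)

  lift-⊙ : ∀ {Γ Δ Θ r} (σ : Sub Δ Θ) (τ : Sub Γ Δ) → lift {t = r} σ ⊙ lift τ ≗ˢ lift (σ ⊙ τ)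
  lift-⊙ σ τ vz     = refl
  lift-⊙ σ τ (vs x) = subT-lift-vs σ (τ x)

  lift-var : ∀ {Γ r} → lift {Γ} {Γ} {r} var ≗ˢ var
  lift-var vz     = refl
  lift-var (vs x) = refl

  sub-cong : ∀ {Γ Δ} {σ τ : Sub Γ Δ} → σ ≗ˢ τ → (A : Fm Γ) → sub σ A ≡ sub τ A
  sub-cong e ⊥'          = refl
  sub-cong e (atom P ts) = cong (atom P) (subTs-cong e ts)
  sub-cong e (t ≐ u)     = cong₂ _≐_ (subT-cong e t) (subT-cong e u)
  sub-cong e (A ⇒ B)     = cong₂ _⇒_ (sub-cong e A) (sub-cong e B)
  sub-cong e (A ∧ B)     = cong₂ _∧_ (sub-cong e A) (sub-cong e B)
  sub-cong e (A ∨ B)     = cong₂ _∨_ (sub-cong e A) (sub-cong e B)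
  sub-cong e (∀' s A)    = cong (∀' s) (sub-cong (lift-cong e) A)
  sub-cong e (∃' s A)    = cong (∃' s) (sub-cong (lift-cong e) A)

  sub-⊙ : ∀ {Γ Δ Θ} (σ : Sub Δ Θ) (τ : Sub Γ Δ) (A : Fm Γ) → sub σ (sub τ A) ≡ sub (σ ⊙ τ) A
  sub-⊙ σ τ ⊥'          = refl
  sub-⊙ σ τ (atom P ts) = cong (atom P) (subTs-⊙ σ τ ts)
  sub-⊙ σ τ (t ≐ u)     = cong₂ _≐_ (subT-⊙ σ τ t) (subT-⊙ σ τ u)
  sub-⊙ σ τ (A ⇒ B)     = cong₂ _⇒_ (sub-⊙ σ τ A) (sub-⊙ σ τ B)
  sub-⊙ σ τ (A ∧ B)     = cong₂ _∧_ (sub-⊙ σ τ A) (sub-⊙ σ τ B)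
  sub-⊙ σ τ (A ∨ B)     = cong₂ _∨_ (sub-⊙ σ τ A) (sub-⊙ σ τ B)
  sub-⊙ σ τ (∀' s A)    = cong (∀' s) (trans (sub-⊙ (lift σ) (lift τ) A) (sub-cong (lift-⊙ σ τ) A))
  sub-⊙ σ τ (∃' s A)    = cong (∃' s) (trans (sub-⊙ (lift σ) (lift τ) A) (sub-cong (lift-⊙ σ τ) A))

  sub-var : ∀ {Γ} (A : Fm Γ) → sub var A ≡ A
  sub-var ⊥'          = refl
  sub-var (atom P ts) = cong (atom P) (subTs-var ts)
  sub-var (t ≐ u)     = cong₂ _≐_ (subT-var t) (subT-var u)
  sub-var (A ⇒ B)     = cong₂ _⇒_ (sub-var A) (sub-var B)
  sub-var (A ∧ B)     = cong₂ _∧_ (sub-var A) (sub-var B)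
  sub-var (A ∨ B)     = cong₂ _∨_ (sub-var A) (sub-var B)
  sub-var (∀' s A)    = cong (∀' s) (trans (sub-cong lift-var A) (sub-var A))
  sub-var (∃' s A)    = cong (∃' s) (trans (sub-cong lift-var A) (sub-var A))

  liftⁿ : ∀ {Γ Δ} k → Sub Γ Δ → Sub (k ⊕ Γ) (k ⊕ Δ)
  liftⁿ zero    σ = σ
  liftⁿ (suc k) σ = lift (liftⁿ k σ)

  wk-liftⁿ : ∀ {Γ Δ s} j (σ : Sub Γ Δ) (t : Tm Γ s) → subT (liftⁿ j σ) (wk j t) ≡ wk j (subT σ t)
  wk-liftⁿ zero    σ t = refl
  wk-liftⁿ (suc j) σ t = trans (subT-lift-vs (liftⁿ j σ) (wk j t)) (cong (ren vs) (wk-liftⁿ j σ t))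

  wk-consT : ∀ {Γ} j (u : Tm Γ ι) (T : Tm Γ lst) → wk j (consT u T) ≡ consT (wk j u) (wk j T)
  wk-consT zero    u T = refl
  wk-consT (suc j) u T = cong (ren vs) (wk-consT j u T)

  consTs-subT : ∀ {Γ Δ} (σ : Sub Γ Δ) (ts : List (Tm Γ ι)) (T : Tm Γ lst) →
                subT σ (consTs ts T) ≡ consTs (map (subT σ) ts) (subT σ T)
  consTs-subT σ []       T = refl
  consTs-subT σ (t ∷ ts) T = cong (consT (subT σ t)) (consTs-subT σ ts T)

  consTs-++ : ∀ {Γ} (ts us : List (Tm Γ ι)) (T : Tm Γ lst) →
              consTs (ts ++ us) T ≡ consTs ts (consTs us T)
  consTs-++ []       us T = refl
  consTs-++ (t ∷ ts) us T = cong (consT t) (consTs-++ ts us T)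

  xs-liftⁿ : ∀ {Γ Δ} j (σ : Sub Γ Δ) → map (subT (liftⁿ j σ)) (xs j) ≡ xs j
  xs-liftⁿ zero    σ = refl
  xs-liftⁿ {Γ} {Δ} (suc j) σ = begin
    map (subT (lift L)) (map (ren vs) (xs j) ++ var vz ∷ [])
      ≡⟨ map-++ (subT (lift L)) (map (ren vs) (xs j)) (var vz ∷ []) ⟩
    map (subT (lift L)) (map (ren vs) (xs j)) ++ var vz ∷ []
      ≡⟨ cong (_++ var vz ∷ []) (map-∘ (xs j)) ⟨
    map (λ u → subT (lift L) (ren vs u)) (xs j) ++ var vz ∷ []
      ≡⟨ cong (_++ var vz ∷ []) (map-cong (subT-lift-vs L) (xs j)) ⟩
    map (λ u → ren vs (subT L u)) (xs j) ++ var vz ∷ []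
      ≡⟨ cong (_++ var vz ∷ []) (map-∘ (xs j)) ⟩
    map (ren vs) (map (subT L) (xs j)) ++ var vz ∷ []
      ≡⟨ cong (λ ys → map (ren vs) ys ++ var vz ∷ []) (xs-liftⁿ j σ) ⟩
    map (ren vs) (xs j) ++ var vz ∷ []
      ∎
    where
    open ≡-Reasoning
    L : Sub (j ⊕ Γ) (j ⊕ Δ)
    L = liftⁿ j σ

  xs-single : ∀ {Γ} j (t : Tm (j ⊕ Γ) ι) → map (subT (single t)) (xs (suc j)) ≡ xs j ++ t ∷ []
  xs-single j t = begin
    map (subT (single t)) (map (ren vs) (xs j) ++ var vz ∷ [])
      ≡⟨ map-++ (subT (single t)) (map (ren vs) (xs j)) (var vz ∷ []) ⟩
    map (subT (single t)) (map (ren vs) (xs j)) ++ t ∷ []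
      ≡⟨ cong (_++ t ∷ []) (map-∘ (xs j)) ⟨
    map (λ u → subT (single t) (ren vs u)) (xs j) ++ t ∷ []
      ≡⟨ cong (_++ t ∷ []) (trans (map-cong (subT-single-vs t) (xs j)) (map-id (xs j))) ⟩
    xs j ++ t ∷ []
      ∎
    where open ≡-Reasoning

  atCons-⊙ : ∀ {Γ Δ Θ} j (T : Tm Δ lst) (ρ : Sub Γ Δ) (σ : Sub Δ Θ) →
             liftⁿ j σ ⊙ atCons j T ρ ≗ˢ atCons j (subT σ T) (σ ⊙ ρ)
  atCons-⊙ j T ρ σ vz     = trans (consTs-subT (liftⁿ j σ) (xs j) (wk j T))
                                  (cong₂ consTs (xs-liftⁿ j σ) (wk-liftⁿ j σ T))
  atCons-⊙ j T ρ σ (vs z) = wk-liftⁿ j σ (ρ z)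

  atCons-single : ∀ {Γ Δ} j (u : Tm Δ ι) (T : Tm Δ lst) (ρ : Sub Γ Δ) →
                  single (wk j u) ⊙ atCons (suc j) T ρ ≗ˢ atCons j (consT u T) ρ
  atCons-single {Δ = Δ} j u T ρ vz = begin
    subT (single t) (consTs (xs (suc j)) (ren vs (wk j T)))
      ≡⟨ consTs-subT (single t) (xs (suc j)) (ren vs (wk j T)) ⟩
    consTs (map (subT (single t)) (xs (suc j))) (subT (single t) (ren vs (wk j T)))
      ≡⟨ cong₂ consTs (xs-single j t) (subT-single-vs t (wk j T)) ⟩
    consTs (xs j ++ t ∷ []) (wk j T)
      ≡⟨ consTs-++ (xs j) (t ∷ []) (wk j T) ⟩
    consTs (xs j) (consT t (wk j T))
      ≡⟨ cong (consTs (xs j)) (wk-consT j u T) ⟨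
    consTs (xs j) (wk j (consT u T))
      ∎
    where
    open ≡-Reasoning
    t : Tm (j ⊕ Δ) ι
    t = wk j u
  atCons-single j u T ρ (vs z) = subT-single-vs (wk j u) (wk j (ρ z))

  sub-∀ⁿ : ∀ {Γ Δ} k (σ : Sub Γ Δ) (A : Fm (k ⊕ Γ)) → sub σ (∀ⁿ k A) ≡ ∀ⁿ k (sub (liftⁿ k σ) A)
  sub-∀ⁿ zero    σ A = refl
  sub-∀ⁿ (suc k) σ A = sub-∀ⁿ k σ (∀' ι A)

  sub-⋀ : ∀ {Γ Δ} m (σ : Sub Γ Δ) (f : ℕ → Fm Γ) → sub σ (⋀ m f) ≡ ⋀ m (λ j → sub σ (f j))
  sub-⋀ zero          σ f = refl
  sub-⋀ (suc zero)    σ f = refl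
  sub-⋀ (suc (suc m)) σ f = cong (sub σ (f 0) ∧_) (sub-⋀ (suc m) σ (λ j → f (suc j)))

  ⋀-cong : ∀ {Γ} m {f g : ℕ → Fm Γ} → (∀ j → f j ≡ g j) → ⋀ m f ≡ ⋀ m g
  ⋀-cong zero          e = refl
  ⋀-cong (suc zero)    e = e 0
  ⋀-cong (suc (suc m)) e = cong₂ _∧_ (e 0) (⋀-cong (suc m) (λ j → e (suc j)))

  wkⁿ : ∀ {Γ} n → Fm Γ → Fm (n ⊕ Γ)
  wkⁿ n A = sub (λ v → wk n (var v)) A

  wkF-wkⁿ : ∀ {Γ} n (A : Fm Γ) → wkF (wkⁿ n A) ≡ wkⁿ (suc n) A
  wkF-wkⁿ n A = trans (sub-⊙ wkS (λ v → wk n (var v)) A)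
                      (sub-cong (λ v → sym (ren-subT vs (wk n (var v)))) A)

  single-liftⁿ-wkⁿ : ∀ {Γ} n (u : Tm (ι ∷ Γ) ι) (A : Fm Γ) →
                     sub (single (wk n u)) (sub (liftⁿ (suc n) wkS) (wkⁿ (suc n) A)) ≡ wkⁿ n (wkF A)
  single-liftⁿ-wkⁿ {Γ} n u A = begin
    sub (single t) (sub (liftⁿ (suc n) wkS) (wkⁿ (suc n) A))
      ≡⟨ cong (sub (single t)) (sub-⊙ (liftⁿ (suc n) wkS) _ A) ⟩
    sub (single t) (sub (liftⁿ (suc n) wkS ⊙ (λ v → wk (suc n) (var v))) A)
      ≡⟨ sub-⊙ (single t) _ A ⟩
    sub (single t ⊙ liftⁿ (suc n) wkS ⊙ (λ v → wk (suc n) (var v))) A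
      ≡⟨ sub-cong pointwise A ⟩
    sub ((λ v → wk n (var v)) ⊙ wkS) A
      ≡⟨ sub-⊙ (λ v → wk n (var v)) wkS A ⟨
    wkⁿ n (wkF A)
      ∎
    where
    open ≡-Reasoning
    t : Tm (n ⊕ (ι ∷ Γ)) ι
    t = wk n u
    pointwise : single t ⊙ liftⁿ (suc n) wkS ⊙ (λ v → wk (suc n) (var v))
                ≗ˢ (λ v → wk n (var v)) ⊙ wkS
    pointwise v = trans (cong (subT (single t)) (wk-liftⁿ (suc n) wkS (var v)))
                        (subT-single-vs t (wk n (var (vs v))))

  ⊆-weaken : ∀ {Γ Δ Δ' A} → Δ ⊆ Δ' → Pf Γ Δ A → Pf Γ Δ' A
  ⊆-weaken h (hyp p)     = hyp (h p)
  ⊆-weaken h (raa p)     = raa (⊆-weaken (∷⁺ʳ _ h) p)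
  ⊆-weaken h (⇒I p)      = ⇒I (⊆-weaken (∷⁺ʳ _ h) p)
  ⊆-weaken h (⇒E p q)    = ⇒E (⊆-weaken h p) (⊆-weaken h q)
  ⊆-weaken h (∧I p q)    = ∧I (⊆-weaken h p) (⊆-weaken h q)
  ⊆-weaken h (∧E₁ p)     = ∧E₁ (⊆-weaken h p)
  ⊆-weaken h (∧E₂ p)     = ∧E₂ (⊆-weaken h p)
  ⊆-weaken h (∨I₁ p)     = ∨I₁ (⊆-weaken h p)
  ⊆-weaken h (∨I₂ p)     = ∨I₂ (⊆-weaken h p)
  ⊆-weaken h (∨E p q r)  = ∨E (⊆-weaken h p) (⊆-weaken (∷⁺ʳ _ h) q) (⊆-weaken (∷⁺ʳ _ h) r)
  ⊆-weaken h (∀I p)      = ∀I (⊆-weaken (map⁺ wkF h) p)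
  ⊆-weaken h (∀E p t)    = ∀E (⊆-weaken h p) t
  ⊆-weaken h (∃I t p)    = ∃I t (⊆-weaken h p)
  ⊆-weaken h (∃E p q)    = ∃E (⊆-weaken h p) (⊆-weaken (∷⁺ʳ _ (map⁺ wkF h)) q)
  ⊆-weaken h (≐refl t)   = ≐refl t
  ⊆-weaken h (≐E A p q)  = ≐E A (⊆-weaken h p) (⊆-weaken h q)

  closed : ∀ {Γ Δ A} → ⊢ A → Pf Γ Δ A
  closed = ⊆-weaken (λ ())

  ⊤-intro : ∀ {Γ Δ} → Pf Γ Δ ⊤'
  ⊤-intro = ⇒I (hyp (here refl))

  ⇒-reflexive : ∀ {Γ} {A B : Fm Γ} → A ≡ B → ⊢ (A ⇒ B)
  ⇒-reflexive refl = ⇒I (hyp (here refl))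

  ⇒-trans : ∀ {Γ} {A B C : Fm Γ} → ⊢ (A ⇒ B) → ⊢ (B ⇒ C) → ⊢ (A ⇒ C)
  ⇒-trans f g = ⇒I (⇒E (closed g) (⇒E (closed f) (hyp (here refl))))

  ⇒-preorder : Ctx → Preorder _ _ _
  ⇒-preorder Γ = record
    { Carrier    = Fm Γ
    ; _≈_        = _≡_
    ; _≲_        = λ A B → ⊢ (A ⇒ B)
    ; isPreorder = record
      { isEquivalence = isEquivalence
      ; reflexive     = ⇒-reflexive
      ; trans         = ⇒-trans
      }
    }

  module ⇒-Reasoning {Γ : Ctx} = PreorderReasoning (⇒-preorder Γ)

  ∧-mono : ∀ {Γ} {A A' B B' : Fm Γ} → ⊢ (A ⇒ A') → ⊢ (B ⇒ B') → ⊢ (A ∧ B ⇒ A' ∧ B')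
  ∧-mono f g = ⇒I (∧I (⇒E (closed f) (∧E₁ (hyp (here refl))))
                      (⇒E (closed g) (∧E₂ (hyp (here refl)))))

  ⇒-mono : ∀ {Γ} {A A' C C' : Fm Γ} → ⊢ (A' ⇒ A) → ⊢ (C ⇒ C') → ⊢ ((A ⇒ C) ⇒ (A' ⇒ C'))
  ⇒-mono f g =
    ⇒I (⇒I (⇒E (closed g) (⇒E (hyp (there (here refl))) (⇒E (closed f) (hyp (here refl))))))

  ∀-elim : ∀ {Γ s} {A : Fm (s ∷ Γ)} (t : Tm Γ s) → ⊢ (∀' s A ⇒ A [ t ])
  ∀-elim t = ⇒I (∀E (hyp (here refl)) t)

  ∀-elim-wkF : ∀ {Γ s} {A : Fm (s ∷ Γ)} → ⊢ (wkF (∀' s A) ⇒ A)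
  ∀-elim-wkF {A = A} = ⇒-trans (∀-elim (var vz)) (⇒-reflexive instance-vz)
    where
    instance-vz : sub (lift wkS) A [ var vz ] ≡ A
    instance-vz = trans (sub-⊙ (single (var vz)) (lift wkS) A)
                        (trans (sub-cong (λ { vz → refl ; (vs x) → refl }) A) (sub-var A))

  ∀-intro : ∀ {Γ s} {A : Fm Γ} {B : Fm (s ∷ Γ)} → ⊢ (wkF A ⇒ B) → ⊢ (A ⇒ ∀' s B)
  ∀-intro f = ⇒I (∀I (⇒E (closed f) (hyp (here refl))))

  ∀-mono : ∀ {Γ s} {A B : Fm (s ∷ Γ)} → ⊢ (A ⇒ B) → ⊢ (∀' s A ⇒ ∀' s B)
  ∀-mono f = ∀-intro (⇒-trans ∀-elim-wkF f)

  ∀-distrib-⇒ : ∀ {Γ s} {A B : Fm (s ∷ Γ)} → ⊢ (∀' s (A ⇒ B) ⇒ (∀' s A ⇒ ∀' s B))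
  ∀-distrib-⇒ = ⇒I (⇒I (∀I (⇒E (⇒E (closed ∀-elim-wkF) (hyp (there (here refl))))
                                (⇒E (closed ∀-elim-wkF) (hyp (here refl))))))

  ∀ⁿ-mono : ∀ {Γ} n {A B : Fm (n ⊕ Γ)} → ⊢ (A ⇒ B) → ⊢ (∀ⁿ n A ⇒ ∀ⁿ n B)
  ∀ⁿ-mono zero    f = f
  ∀ⁿ-mono (suc n) f = ∀ⁿ-mono n (∀-mono f)

  ∀ⁿ-distrib-⇒ : ∀ {Γ} n {A B : Fm (n ⊕ Γ)} → ⊢ (∀ⁿ n (A ⇒ B) ⇒ (∀ⁿ n A ⇒ ∀ⁿ n B))
  ∀ⁿ-distrib-⇒ zero    = ⇒I (hyp (here refl))
  ∀ⁿ-distrib-⇒ (suc n) = ⇒-trans (∀ⁿ-mono n ∀-distrib-⇒) (∀ⁿ-distrib-⇒ n)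

  ∀ⁿ-generalize : ∀ {Γ} n (A : Fm Γ) → ⊢ (A ⇒ ∀ⁿ n (wkⁿ n A))
  ∀ⁿ-generalize zero    A = ⇒-reflexive (sym (sub-var A))
  ∀ⁿ-generalize (suc n) A =
    ⇒-trans (∀ⁿ-generalize n A) (∀ⁿ-mono n (∀-intro (⇒-reflexive (wkF-wkⁿ n A))))

  ⋀-intro : ∀ {Γ Δ} m (f : ℕ → Fm Γ) → (∀ j → j < m → Pf Γ Δ (f j)) → Pf Γ Δ (⋀ m f)
  ⋀-intro zero          f p = ⊤-intro
  ⋀-intro (suc zero)    f p = p 0 z<s
  ⋀-intro (suc (suc m)) f p =
    ∧I (p 0 z<s) (⋀-intro (suc m) (λ j → f (suc j)) (λ j j<m → p (suc j) (s≤s j<m)))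

  ⋀-elim : ∀ {Γ Δ} m (f : ℕ → Fm Γ) → Pf Γ Δ (⋀ m f) → ∀ j → j < m → Pf Γ Δ (f j)
  ⋀-elim (suc zero)    f p zero    _         = p
  ⋀-elim (suc zero)    f p (suc j) (s≤s ())
  ⋀-elim (suc (suc m)) f p zero    _         = ∧E₁ p
  ⋀-elim (suc (suc m)) f p (suc j) (s≤s j<m) = ⋀-elim (suc m) (λ k → f (suc k)) (∧E₂ p) j j<m

  module _ {Γ : Ctx} (φ : Fm (lst ∷ Γ)) where

    X≔cons : ∀ j → Sub (lst ∷ Γ) (j ⊕ (lst ∷ Γ))
    X≔cons j = atCons j (var vz) wk1S

    X≔nil : Sub (lst ∷ Γ) Γ
    X≔nil = atCons 0 nilT idS

    φ-at : ℕ → Fm (lst ∷ Γ)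
    φ-at j = ∀ⁿ j (sub (X≔cons j) φ)

    φ-step : ℕ → Fm (lst ∷ Γ)
    φ-step m = ∀ⁿ m (wkⁿ m φ ⇒ sub (X≔cons m) φ)

    φ-at-zero : sub (X≔cons 0) φ ≡ φ
    φ-at-zero = trans (sub-cong (λ { vz → refl ; (vs z) → refl }) φ) (sub-var φ)

    φ-at-nil : ∀ j → sub X≔nil (φ-at j) ≡ ∀ⁿ j (sub (atCons j nilT idS) φ)
    φ-at-nil j = trans (sub-∀ⁿ j X≔nil _) (cong (∀ⁿ j)
      (trans (sub-⊙ (liftⁿ j X≔nil) (X≔cons j) φ) (sub-cong (atCons-⊙ j (var vz) wk1S X≔nil) φ)))

    -- φ(cons(x₁,…,xⱼ,x;X)) ≡ φ(cons(x₁,…,xⱼ;cons(x,X))), with x the innermost variable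
    cons-shift : ∀ j → sub (single (wk j (var vz))) (sub (liftⁿ (suc j) wkS) (sub (X≔cons (suc j)) φ))
                       ≡ sub (liftⁿ j (X≔cons 1)) (sub (X≔cons j) φ)
    cons-shift j = begin
      sub S (sub (liftⁿ (suc j) wkS) (sub (X≔cons (suc j)) φ))
        ≡⟨ cong (sub S) (sub-⊙ (liftⁿ (suc j) wkS) (X≔cons (suc j)) φ) ⟩
      sub S (sub (liftⁿ (suc j) wkS ⊙ X≔cons (suc j)) φ)
        ≡⟨ cong (sub S) (sub-cong (atCons-⊙ (suc j) (var vz) wk1S wkS) φ) ⟩
      sub S (sub (atCons (suc j) (var (vs vz)) (wkS ⊙ wk1S)) φ)
        ≡⟨ sub-⊙ S (atCons (suc j) (var (vs vz)) (wkS ⊙ wk1S)) φ ⟩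
      sub (S ⊙ atCons (suc j) (var (vs vz)) (wkS ⊙ wk1S)) φ
        ≡⟨ sub-cong (atCons-single j (var vz) (var (vs vz)) (wkS ⊙ wk1S)) φ ⟩
      sub (atCons j (consT (var vz) (var (vs vz))) (wkS ⊙ wk1S)) φ
        ≡⟨ sub-cong (atCons-⊙ j (var vz) wk1S (X≔cons 1)) φ ⟨
      sub (liftⁿ j (X≔cons 1) ⊙ X≔cons j) φ
        ≡⟨ sub-⊙ (liftⁿ j (X≔cons 1)) (X≔cons j) φ ⟨
      sub (liftⁿ j (X≔cons 1)) (sub (X≔cons j) φ)
        ∎
      where
      open ≡-Reasoning
      S : Sub (suc j ⊕ (ι ∷ lst ∷ Γ)) (j ⊕ (ι ∷ lst ∷ Γ))
      S = single (wk j (var vz))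

    φ-at-suc⇒φ-at-cons : ∀ j → ⊢ (wkF (φ-at (suc j)) ⇒ sub (X≔cons 1) (φ-at j))
    φ-at-suc⇒φ-at-cons j = begin
      wkF (φ-at (suc j))                                  ≡⟨ sub-∀ⁿ (suc j) wkS _ ⟩
      ∀ⁿ j (∀' ι D)                                       ≲⟨ ∀ⁿ-mono j (∀-elim (wk j (var vz))) ⟩
      ∀ⁿ j (D [ wk j (var vz) ])                          ≡⟨ cong (∀ⁿ j) (cons-shift j) ⟩
      ∀ⁿ j (sub (liftⁿ j (X≔cons 1)) (sub (X≔cons j) φ))  ≡⟨ sub-∀ⁿ j (X≔cons 1) _ ⟨
      sub (X≔cons 1) (φ-at j)                             ∎
      where
      open ⇒-Reasoning
      D : Fm (suc j ⊕ (ι ∷ lst ∷ Γ))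
      D = sub (liftⁿ (suc j) wkS) (sub (X≔cons (suc j)) φ)

    φ-step⇒φ-at-cons : ∀ n → ⊢ (wkF φ ⇒ wkF (φ-step (suc n)) ⇒ sub (X≔cons 1) (φ-at n))
    φ-step⇒φ-at-cons n = ⇒I (⇒I (subst (Pf _ _) (sym (sub-∀ⁿ n (X≔cons 1) _))
      (⇒E (⇒E (closed (∀ⁿ-distrib-⇒ n)) (⇒E (closed step-instance) (hyp (here refl))))
          (⇒E (closed (∀ⁿ-generalize n (wkF φ))) (hyp (there (here refl)))))))
      where
      open ⇒-Reasoning
      t : Tm (n ⊕ (ι ∷ lst ∷ Γ)) ι
      t = wk n (var vz)
      W : Fm (suc n ⊕ (ι ∷ lst ∷ Γ))
      W = sub (liftⁿ (suc n) wkS) (wkⁿ (suc n) φ ⇒ sub (X≔cons (suc n)) φ)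
      step-instance : ⊢ (wkF (φ-step (suc n))
                         ⇒ ∀ⁿ n (wkⁿ n (wkF φ) ⇒ sub (liftⁿ n (X≔cons 1)) (sub (X≔cons n) φ)))
      step-instance = begin
        wkF (φ-step (suc n))
          ≡⟨ sub-∀ⁿ (suc n) wkS _ ⟩
        ∀ⁿ n (∀' ι W)
          ≲⟨ ∀ⁿ-mono n (∀-elim t) ⟩
        ∀ⁿ n (W [ t ])
          ≡⟨ cong (∀ⁿ n) (cong₂ _⇒_ (single-liftⁿ-wkⁿ n (var vz) φ) (cons-shift n)) ⟩
        ∀ⁿ n (wkⁿ n (wkF φ) ⇒ sub (liftⁿ n (X≔cons 1)) (sub (X≔cons n) φ))
          ∎

    Ψ-at-nil : ∀ m → sub X≔nil (Ψ m φ) ≡ ⋀ m (λ j → ∀ⁿ j (sub (atCons j nilT idS) φ))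
    Ψ-at-nil m = trans (sub-⋀ m X≔nil φ-at) (⋀-cong m φ-at-nil)

    Ψ-step : ∀ n → ⊢ (wkF (φ-step (suc n)) ⇒ wkF (Ψ (suc n) φ) ⇒ sub (X≔cons 1) (Ψ (suc n) φ))
    Ψ-step n = ⇒I (⇒I (subst (Pf _ _) (sym (sub-⋀ m (X≔cons 1) φ-at)) (⋀-intro m _ component)))
      where
      m : ℕ
      m = suc n
      Hyps : List (Fm (ι ∷ lst ∷ Γ))
      Hyps = wkF (Ψ m φ) ∷ wkF (φ-step m) ∷ []
      conjunct : ∀ j → j < m → Pf _ Hyps (wkF (φ-at j))
      conjunct = ⋀-elim m _ (subst (Pf _ _) (sub-⋀ m wkS φ-at) (hyp (here refl)))
      component : ∀ j → j < m → Pf _ Hyps (sub (X≔cons 1) (φ-at j))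
      component j j<m with m<1+n⇒m<n∨m≡n j<m
      ... | inj₁ j<n  = ⇒E (closed (φ-at-suc⇒φ-at-cons j)) (conjunct (suc j) (s≤s j<n))
      ... | inj₂ refl = ⇒E (⇒E (closed (φ-step⇒φ-at-cons n))
                              (subst (Pf _ _) (cong wkF φ-at-zero) (conjunct 0 z<s)))
                           (hyp (there (here refl)))

    Ψ-induction : ∀ n → ⊢ (IX (Ψ (suc n) φ) ⇒ Im (suc n) φ)
    Ψ-induction n = ⇒-mono (∧-mono base step) conclusion
      where
      m : ℕ
      m = suc n
      ψ : Fm (lst ∷ Γ)
      ψ = Ψ m φ
      base : ⊢ (⋀ m (λ j → ∀ⁿ j (sub (atCons j nilT idS) φ)) ⇒ sub X≔nil ψ)
      base = ⇒-reflexive (sym (Ψ-at-nil m))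
      step : ⊢ (∀' lst (φ-step m) ⇒ ∀' lst (∀' ι (wkF ψ ⇒ sub (X≔cons 1) ψ)))
      step = ∀-mono (∀-intro (Ψ-step n))
      conclusion : ⊢ (∀' lst ψ ⇒ ∀' lst φ)
      conclusion = ∀-mono (⇒I (subst (Pf _ _) φ-at-zero (⋀-elim m φ-at (hyp (here refl)) 0 z<s)))

lemma3p3 : (Σ : Signature) → let open Syntax Σ in
    (m : ℕ) → 1 ≤ m → (Γ : Ctx) (φ : Fm (lst ∷ Γ)) →
    ⊢ (IX (Ψ m φ) ⇒ Im m φ)
lemma3p3 Σ (suc n) (s≤s z≤n) Γ φ = Ψ-induction Σ φ n
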